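{- Let $s,t,s',t'$ be terms such that $(s\unrhd t) \approx (s'\unrhd t')$. Then $s\unrhd t$ and $s'\unrhd t'$ have exactly the same solutions. In particular, $s \unrhd t$ holds if and only if $s'\unrhd t'$ holds.
   Context: Terms are simply typed $\lambda$-terms identified up to $\alpha\beta\eta$-conversion. Constants are partitioned into nominal constants $\mathcal{C}$ (infinitely many of each relevant type) and other constants. $\mathrm{supp}(t)$ is the set of nominal constants in $t$. A permutation is a type-preserving bijection $\pi$ of $\mathcal{C}$ moving finitely many elements, applied homomorphically to terms (fixing non-nominal atoms and commuting with abstraction and application); $B \approx B'$ means $B$ $\lambda$-converts to $\pi.B'$ for some permutation $\pi$. A substitution $\theta$ is a type-preserving map from variables to terms, identity on all but finitely many variables; $\mathrm{supp}(\theta)$ is the set of nominal constants in its range; $B[\theta]$ is ordinary capture-avoiding substitution and $B\langle\theta\rangle = (\pi.B)[\theta]$ where $\pi$ is any permutation mapping $\mathrm{supp}(B)$ to constants outside $\mathrm{supp}(\theta)$. For $n\ge 0$, $s$ of type $\tau_1\to\cdots\to\tau_n\to\tau$ and $t$ of type $\tau$, the expression $s\unrhd t$ (a nominal abstraction of degree $n$) is a single formula; it is said to hold if $s$ $\lambda$-converts to $\lambda c_1\ldots\lambda c_n.t$ for some distinct nominal constants $c_1,\ldots,c_n$, where $\lambda c_1\ldots\lambda c_n.t$ denotes $\lambda y_1\ldots\lambda y_n.t'$ with $t'$ obtained from $t$ by replacing each $c_i$ by a fresh variable $y_i$. $(s\unrhd t)\approx(s'\unrhd t')$ is meant with $s\unrhd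 t$ regarded as a single term. A substitution $\theta$ is a solution to $s\unrhd t$ if $(s\unrhd t)\langle\theta\rangle$, i.e., the nominal capture-avoiding application of $\theta$ to the whole formula $s\unrhd t$, yields some $s''\unrhd t''$ that holds. -}

module Defs where

open import Data.Nat using (ℕ)
import Data.Nat as ℕ
open import Data.List using (List; []; _∷_; _++_)
open import Data.List.Membership.Propositional using (_∈_)
open import Data.List.Relation.Unary.All using (All; []; _∷_)
open import Data.List.Relation.Unary.Unique.Propositional using (Unique)
open import Data.Product using (Σ; ∃; ∃-syntax; _×_; _,_; proj₁)
open import Data.Sum using (_⊎_)
open import Relation.Binary.PropositionalEquality using (_≡_; refl)
open import Relation.Nullary using (¬_; Dec; yes; no)

infixr 7 _⇒_
data Ty : Set where
  base : ℕ → Ty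
  _⇒_  : Ty → Ty → Ty

_≟Ty_ : (σ τ : Ty) → Dec (σ ≡ τ)
base m ≟Ty base n with m ℕ.≟ n
... | yes refl = yes refl
... | no ne = no λ { refl → ne refl }
base _ ≟Ty (_ ⇒ _) = no λ ()
(_ ⇒ _) ≟Ty base _ = no λ ()
(a ⇒ b) ≟Ty (c ⇒ d) with a ≟Ty c | b ≟Ty d
... | yes refl | yes refl = yes refl
... | no ne | _ = no λ { refl → ne refl }
... | yes _ | no ne = no λ { refl → ne refl }

_⇒*_ : List Ty → Ty → Ty
[] ⇒* τ = τ
(σ ∷ σs) ⇒* τ = σ ⇒ (σs ⇒* τ)

Ctx : Set
Ctx = List Ty

-- Raw intrinsically typed terms (de Bruijn for bound variables, so α is
-- built in).  Atoms: free (substitutable) variables fv, nominal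
-- constants nom (infinitely many of each type), other constants cst.

data _∋_ : Ctx → Ty → Set where
  here  : ∀ {Γ τ} → (τ ∷ Γ) ∋ τ
  there : ∀ {Γ σ τ} → Γ ∋ τ → (σ ∷ Γ) ∋ τ

data Tm (Γ : Ctx) : Ty → Set where
  var : ∀ {τ} → Γ ∋ τ → Tm Γ τ
  fv  : (τ : Ty) → ℕ → Tm Γ τ
  nom : (τ : Ty) → ℕ → Tm Γ τ
  cst : (τ : Ty) → ℕ → Tm Γ τ
  lam : ∀ {σ τ} → Tm (σ ∷ Γ) τ → Tm Γ (σ ⇒ τ)
  app : ∀ {σ τ} → Tm Γ (σ ⇒ τ) → Tm Γ σ → Tm Γ τ

NC : Set
NC = Ty × ℕ

Var : Set
Var = Ty × ℕ

Ren : Ctx → Ctx → Set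
Ren Γ Δ = ∀ {τ} → Γ ∋ τ → Δ ∋ τ

liftR : ∀ {Γ Δ σ} → Ren Γ Δ → Ren (σ ∷ Γ) (σ ∷ Δ)
liftR ρ here = here
liftR ρ (there x) = there (ρ x)

ren : ∀ {Γ Δ τ} → Ren Γ Δ → Tm Γ τ → Tm Δ τ
ren ρ (var x) = var (ρ x)
ren ρ (fv τ n) = fv τ n
ren ρ (nom τ n) = nom τ n
ren ρ (cst τ n) = cst τ n
ren ρ (lam b) = lam (ren (liftR ρ) b)
ren ρ (app f a) = app (ren ρ f) (ren ρ a)

wk : ∀ {Γ σ τ} → Tm Γ τ → Tm (σ ∷ Γ) τ
wk = ren there

wk0 : ∀ {Γ τ} → Tm [] τ → Tm Γ τ
wk0 = ren λ ()

Sub : Ctx → Ctx → Set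
Sub Γ Δ = ∀ {τ} → Γ ∋ τ → Tm Δ τ

liftS : ∀ {Γ Δ σ} → Sub Γ Δ → Sub (σ ∷ Γ) (σ ∷ Δ)
liftS s here = var here
liftS s (there x) = wk (s x)

sub : ∀ {Γ Δ τ} → Sub Γ Δ → Tm Γ τ → Tm Δ τ
sub s (var x) = s x
sub s (fv τ n) = fv τ n
sub s (nom τ n) = nom τ n
sub s (cst τ n) = cst τ n
sub s (lam b) = lam (sub (liftS s) b)
sub s (app f a) = app (sub s f) (sub s a)

_[_]₀ : ∀ {Γ σ τ} → Tm (σ ∷ Γ) τ → Tm Γ σ → Tm Γ τ
b [ a ]₀ = sub (λ { here → a ; (there x) → var x }) b

infix 4 _≃_
data _≃_ {Γ : Ctx} : ∀ {τ} → Tm Γ τ → Tm Γ τ → Set where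
  ≃-refl  : ∀ {τ} {a : Tm Γ τ} → a ≃ a
  ≃-sym   : ∀ {τ} {a b : Tm Γ τ} → a ≃ b → b ≃ a
  ≃-trans : ∀ {τ} {a b c : Tm Γ τ} → a ≃ b → b ≃ c → a ≃ c
  ≃-lam   : ∀ {σ τ} {a b : Tm (σ ∷ Γ) τ} → a ≃ b → lam a ≃ lam b
  ≃-app   : ∀ {σ τ} {f g : Tm Γ (σ ⇒ τ)} {a b : Tm Γ σ} →
            f ≃ g → a ≃ b → app f a ≃ app g b
  ≃-β     : ∀ {σ τ} (b : Tm (σ ∷ Γ) τ) (a : Tm Γ σ) → app (lam b) a ≃ b [ a ]₀
  ≃-η     : ∀ {σ τ} (f : Tm Γ (σ ⇒ τ)) → lam (app (wk f) (var here)) ≃ f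

-- support of a term (up to λ-conversion): the nominal constants that
-- occur in every representative of its conversion class (equivalently,
-- in its βη-normal form)

data Occurs {Γ : Ctx} (c : NC) : ∀ {τ} → Tm Γ τ → Set where
  occ-nom  : Occurs c (nom (proj₁ c) (Data.Product.proj₂ c))
  occ-lam  : ∀ {σ τ} {b : Tm (σ ∷ Γ) τ} → Occurs c b → Occurs c (lam b)
  occ-appˡ : ∀ {σ τ} {f : Tm Γ (σ ⇒ τ)} {a : Tm Γ σ} → Occurs c f → Occurs c (app f a)
  occ-appʳ : ∀ {σ τ} {f : Tm Γ (σ ⇒ τ)} {a : Tm Γ σ} → Occurs c a → Occurs c (app f a)

_∈supp_ : ∀ {τ} → NC → Tm [] τ → Set
c ∈supp t = ∀ t' → t' ≃ t → Occurs c t'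

record Perm : Set where
  field
    to      : Ty → ℕ → ℕ
    from    : Ty → ℕ → ℕ
    to-from : ∀ τ n → to τ (from τ n) ≡ n
    from-to : ∀ τ n → from τ (to τ n) ≡ n
    finite  : ∃[ L ] (∀ τ n → ¬ ((τ , n) ∈ L) → to τ n ≡ n)
open Perm public

_·nc_ : Perm → NC → NC
π ·nc (τ , n) = τ , to π τ n

_·_ : ∀ {Γ τ} → Perm → Tm Γ τ → Tm Γ τ
π · var x = var x
π · fv τ n = fv τ n
π · nom τ n = nom τ (to π τ n)
π · cst τ n = cst τ n
π · lam b = lam (π · b)
π · app f a = app (π · f) (π · a)

record Subst : Set where
  field
    apply  : (τ : Ty) → ℕ → Tm [] τ
    finite : ∃[ L ] (∀ τ n → ¬ ((τ , n) ∈ L) → apply τ n ≡ fv τ n)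
open Subst public

_[_] : ∀ {Γ τ} → Tm Γ τ → Subst → Tm Γ τ
var x [ θ ] = var x
fv τ n [ θ ] = wk0 (apply θ τ n)
nom τ n [ θ ] = nom τ n
cst τ n [ θ ] = cst τ n
lam b [ θ ] = lam (b [ θ ])
app f a [ θ ] = app (f [ θ ]) (a [ θ ])

_∈suppS_ : NC → Subst → Set
c ∈suppS θ = ∃[ x ] (c ∈supp apply θ (proj₁ x) (Data.Product.proj₂ x))

posV : ∀ (Δ : Ctx) {Γ σ} → (Δ ++ σ ∷ Γ) ∋ σ
posV [] = here
posV (_ ∷ Δ) = there (posV Δ)

insV : ∀ (Δ : Ctx) {Γ σ τ} → (Δ ++ Γ) ∋ τ → (Δ ++ σ ∷ Γ) ∋ τ
insV [] x = there x
insV (_ ∷ Δ) here = here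
insV (_ ∷ Δ) (there x) = there (insV Δ x)

-- replace the nominal constant (σ , k) by the variable bound just
-- outside Δ
absAt : ∀ (Δ : Ctx) {Γ τ} (σ : Ty) (k : ℕ) → Tm (Δ ++ Γ) τ → Tm (Δ ++ σ ∷ Γ) τ
absAt Δ σ k (var x) = var (insV Δ x)
absAt Δ σ k (fv τ n) = fv τ n
absAt Δ σ k (nom τ n) with τ ≟Ty σ | n ℕ.≟ k
... | yes refl | yes refl = var (posV Δ)
... | yes _ | no _ = nom τ n
... | no _ | _ = nom τ n
absAt Δ σ k (cst τ n) = cst τ n
absAt Δ σ k (lam {σ = ρ} b) = lam (absAt (ρ ∷ Δ) σ k b)
absAt Δ σ k (app f a) = app (absAt Δ σ k f) (absAt Δ σ k a)

-- a list of nominal constants c₁,…,cₙ with types τ₁,…,τₙ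
NCs : List Ty → Set
NCs τs = All (λ _ → ℕ) τs

ncs : ∀ {τs} → NCs τs → List NC
ncs [] = []
ncs (_∷_ {x = σ} k ks) = (σ , k) ∷ ncs ks

lamN : ∀ {τs τ} → NCs τs → Tm [] τ → Tm [] (τs ⇒* τ)
lamN [] t = t
lamN (_∷_ {x = σ} k ks) t = lam (absAt [] σ k (lamN ks t))

-- nominal abstraction s ⊵ t of degree n = length τs

Holds : ∀ {τs τ} → Tm [] (τs ⇒* τ) → Tm [] τ → Set
Holds {τs} s t = ∃[ cs ] (Unique (ncs {τs} cs) × s ≃ lamN cs t)

_∈supp⊵_,_ : ∀ {τs τ} → NC → Tm [] (τs ⇒* τ) → Tm [] τ → Set
c ∈supp⊵ s , t = c ∈supp s ⊎ c ∈supp t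

-- θ is a solution to s ⊵ t: (s ⊵ t)⟨θ⟩ = (π.(s ⊵ t))[θ] holds, for a
-- permutation π mapping supp(s ⊵ t) outside supp(θ)
Solution : ∀ {τs τ} → Subst → Tm [] (τs ⇒* τ) → Tm [] τ → Set
Solution θ s t =
  ∃[ π ] ((∀ c → c ∈supp⊵ s , t → ¬ ((π ·nc c) ∈suppS θ))
          × Holds ((π · s) [ θ ]) ((π · t) [ θ ]))

_⊵_≈⊵_⊵_ : ∀ {τs τ} → Tm [] (τs ⇒* τ) → Tm [] τ → Tm [] (τs ⇒* τ) → Tm [] τ → Set
s ⊵ t ≈⊵ s' ⊵ t' = ∃[ π ] (s ≃ π · s' × t ≃ π · t')

-- Permutations of nominal constants and the substitutions [θ] both commute with the term
-- constructors, with weakening and with β-instantiation, so they preserve λ-conversion.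
-- Being injective, a permutation also commutes with abstracting a nominal constant, so it
-- maps λc₁…λcₙ.t to λ(π c₁)…λ(π cₙ).(π.t) with the π cᵢ still distinct: holding of a
-- nominal abstraction is invariant under permutation, and its support moves along with π.
-- If s ⊵ t λ-converts to π.(s' ⊵ t') and θ solves s' ⊵ t' via the permutation ρ, then θ
-- solves s ⊵ t via ρ ∘ π⁻¹: this permutation sends supp(s ⊵ t) = π.supp(s' ⊵ t') to where
-- ρ sends supp(s' ⊵ t'), and (ρ ∘ π⁻¹).(s ⊵ t) λ-converts to ρ.(s' ⊵ t').
-- Since ≈ is symmetric, this gives both directions.
module Submission where

open import Defs
open import Data.Empty using (⊥-elim)
open import Data.List using (List; []; _∷_; _++_; map)
open import Data.List.Membership.Propositional.Properties using (∈-++⁺ˡ; ∈-++⁺ʳ)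
open import Data.List.Relation.Unary.All using ([]; _∷_)
open import Data.List.Relation.Unary.Unique.Propositional using (Unique)
open import Data.List.Relation.Unary.Unique.Propositional.Properties using (map⁺)
open import Data.Nat using (ℕ)
open import Data.Product using (_×_; _,_; proj₁; proj₂)
open import Data.Sum using (inj₁; inj₂)
open import Function.Bundles using (_⇔_; mk⇔)
open import Level using (0ℓ)
open import Relation.Binary.Bundles using (Setoid)
open import Relation.Binary.PropositionalEquality
  using (_≡_; refl; sym; trans; cong; cong₂; subst; module ≡-Reasoning)
open import Relation.Nullary using (¬_; yes; no)
import Data.Nat as ℕ
import Relation.Binary.Reasoning.Setoid as SetoidReasoning

≃-setoid : Ctx → Ty → Setoid 0ℓ 0ℓ
≃-setoid Γ τ = record
  { Carrier = Tm Γ τ ; _≈_ = _≃_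
  ; isEquivalence = record { refl = ≃-refl ; sym = ≃-sym ; trans = ≃-trans } }

module ≃-Reasoning {Γ τ} = SetoidReasoning (≃-setoid Γ τ)

≡⇒≃ : ∀ {Γ τ} {a b : Tm Γ τ} → a ≡ b → a ≃ b
≡⇒≃ refl = ≃-refl

ren-∘ : ∀ {Γ Δ Θ τ} (ρ : Ren Δ Θ) (ρ' : Ren Γ Δ) (ρ'' : Ren Γ Θ) →
        (∀ {σ} (x : Γ ∋ σ) → ρ (ρ' x) ≡ ρ'' x) →
        (a : Tm Γ τ) → ren ρ (ren ρ' a) ≡ ren ρ'' a
ren-∘ ρ ρ' ρ'' e (var x) = cong var (e x)
ren-∘ ρ ρ' ρ'' e (fv τ n) = refl
ren-∘ ρ ρ' ρ'' e (nom τ n) = refl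
ren-∘ ρ ρ' ρ'' e (cst τ n) = refl
ren-∘ ρ ρ' ρ'' e (lam b) =
  cong lam (ren-∘ (liftR ρ) (liftR ρ') (liftR ρ'') (λ { here → refl ; (there x) → cong there (e x) }) b)
ren-∘ ρ ρ' ρ'' e (app f a) = cong₂ app (ren-∘ ρ ρ' ρ'' e f) (ren-∘ ρ ρ' ρ'' e a)

sub-ren≡ren : ∀ {Γ Δ Θ τ} (s : Sub Δ Θ) (ρ : Ren Γ Δ) (ρ' : Ren Γ Θ) →
              (∀ {σ} (x : Γ ∋ σ) → s (ρ x) ≡ var (ρ' x)) →
              (a : Tm Γ τ) → sub s (ren ρ a) ≡ ren ρ' a
sub-ren≡ren s ρ ρ' e (var x) = e x
sub-ren≡ren s ρ ρ' e (fv τ n) = refl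
sub-ren≡ren s ρ ρ' e (nom τ n) = refl
sub-ren≡ren s ρ ρ' e (cst τ n) = refl
sub-ren≡ren s ρ ρ' e (lam b) =
  cong lam (sub-ren≡ren (liftS s) (liftR ρ) (liftR ρ') (λ { here → refl ; (there x) → cong wk (e x) }) b)
sub-ren≡ren s ρ ρ' e (app f a) = cong₂ app (sub-ren≡ren s ρ ρ' e f) (sub-ren≡ren s ρ ρ' e a)

ren-wk0 : ∀ {Γ Δ τ} (ρ : Ren Γ Δ) (u : Tm [] τ) → ren ρ (wk0 u) ≡ wk0 u
ren-wk0 ρ = ren-∘ ρ _ _ λ ()

sub-wk0 : ∀ {Γ Δ τ} (s : Sub Γ Δ) (u : Tm [] τ) → sub s (wk0 u) ≡ wk0 u
sub-wk0 s = sub-ren≡ren s _ _ λ ()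

module Compatible {Γ Γ' : Ctx} (F : ∀ Δ {τ} → Tm (Δ ++ Γ) τ → Tm (Δ ++ Γ') τ)
  (F-var-here : ∀ Δ {σ} → F (σ ∷ Δ) (var here) ≡ var here)
  (F-lam : ∀ Δ {σ τ} (b : Tm (σ ∷ Δ ++ Γ) τ) → F Δ (lam b) ≡ lam (F (σ ∷ Δ) b))
  (F-app : ∀ Δ {σ τ} (f : Tm (Δ ++ Γ) (σ ⇒ τ)) a → F Δ (app f a) ≡ app (F Δ f) (F Δ a))
  (F-wk : ∀ Δ {σ τ} (a : Tm (Δ ++ Γ) τ) → F (σ ∷ Δ) (wk a) ≡ wk (F Δ a))
  (F-[]₀ : ∀ Δ {σ τ} (b : Tm (σ ∷ Δ ++ Γ) τ) a → F Δ (b [ a ]₀) ≡ F (σ ∷ Δ) b [ F Δ a ]₀)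
  where

  F-≃ : ∀ Δ {τ} {a b : Tm (Δ ++ Γ) τ} → a ≃ b → F Δ a ≃ F Δ b
  F-≃ Δ ≃-refl = ≃-refl
  F-≃ Δ (≃-sym e) = ≃-sym (F-≃ Δ e)
  F-≃ Δ (≃-trans e e') = ≃-trans (F-≃ Δ e) (F-≃ Δ e')
  F-≃ Δ (≃-lam {σ} {a = a} {b} e) = begin
    F Δ (lam a)        ≡⟨ F-lam Δ a ⟩
    lam (F (σ ∷ Δ) a)  ≈⟨ ≃-lam (F-≃ (σ ∷ Δ) e) ⟩
    lam (F (σ ∷ Δ) b)  ≡⟨ F-lam Δ b ⟨
    F Δ (lam b)        ∎
    where open ≃-Reasoning
  F-≃ Δ (≃-app {f = f} {g} {a} {b} e e') = begin
    F Δ (app f a)          ≡⟨ F-app Δ f a ⟩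
    app (F Δ f) (F Δ a)    ≈⟨ ≃-app (F-≃ Δ e) (F-≃ Δ e') ⟩
    app (F Δ g) (F Δ b)    ≡⟨ F-app Δ g b ⟨
    F Δ (app g b)          ∎
    where open ≃-Reasoning
  F-≃ Δ (≃-β {σ} b a) = begin
    F Δ (app (lam b) a)                ≡⟨ trans (F-app Δ (lam b) a) (cong (λ f → app f (F Δ a)) (F-lam Δ b)) ⟩
    app (lam (F (σ ∷ Δ) b)) (F Δ a)    ≈⟨ ≃-β (F (σ ∷ Δ) b) (F Δ a) ⟩
    F (σ ∷ Δ) b [ F Δ a ]₀             ≡⟨ F-[]₀ Δ b a ⟨
    F Δ (b [ a ]₀)                     ∎
    where open ≃-Reasoning
  F-≃ Δ (≃-η {σ} f) = begin
    F Δ (lam (app (wk f) (var here)))  ≡⟨ F-lam Δ _ ⟩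
    lam (F (σ ∷ Δ) (app (wk f) (var here)))
      ≡⟨ cong lam (trans (F-app (σ ∷ Δ) (wk f) (var here)) (cong₂ app (F-wk Δ f) (F-var-here Δ))) ⟩
    lam (app (wk (F Δ f)) (var here))  ≈⟨ ≃-η (F Δ f) ⟩
    F Δ f                              ∎
    where open ≃-Reasoning

idᴾ : Perm
idᴾ = record
  { to = λ _ n → n ; from = λ _ n → n ; to-from = λ _ _ → refl ; from-to = λ _ _ → refl
  ; finite = [] , λ _ _ _ → refl }

infix 30 _⁻¹ᴾ
_⁻¹ᴾ : Perm → Perm
π ⁻¹ᴾ = record
  { to = from π ; from = to π ; to-from = from-to π ; from-to = to-from π
  ; finite = proj₁ (finite π) , λ τ n n∉ →
      trans (cong (from π τ) (sym (proj₂ (finite π) τ n n∉))) (from-to π τ n) }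

infixr 25 _∘ᴾ_
_∘ᴾ_ : Perm → Perm → Perm
α ∘ᴾ β = record
  { to = λ τ n → to α τ (to β τ n)
  ; from = λ τ n → from β τ (from α τ n)
  ; to-from = λ τ n → trans (cong (to α τ) (to-from β τ (from α τ n))) (to-from α τ n)
  ; from-to = λ τ n → trans (cong (from β τ) (from-to α τ (to β τ n))) (from-to β τ n)
  ; finite = Lα ++ Lβ , λ τ n n∉ →
      trans (cong (to α τ) (fixβ τ n (λ n∈ → n∉ (∈-++⁺ʳ Lα n∈)))) (fixα τ n (λ n∈ → n∉ (∈-++⁺ˡ n∈)))
  }
  where
  Lα = proj₁ (finite α)
  Lβ = proj₁ (finite β)
  fixα = proj₂ (finite α)
  fixβ = proj₂ (finite β)

to-injective : (π : Perm) (τ : Ty) {m n : ℕ} → to π τ m ≡ to π τ n → m ≡ n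
to-injective π τ {m} {n} e = begin
  m                    ≡⟨ from-to π τ m ⟨
  from π τ (to π τ m)  ≡⟨ cong (from π τ) e ⟩
  from π τ (to π τ n)  ≡⟨ from-to π τ n ⟩
  n                    ∎
  where open ≡-Reasoning

·nc-injective : (π : Perm) {c d : NC} → π ·nc c ≡ π ·nc d → c ≡ d
·nc-injective π {σ , k} {σ' , k'} e with cong proj₁ e
... | refl = cong (σ ,_) (to-injective π σ (cong proj₂ e))

·-∘ : ∀ {Γ τ} (α β γ : Perm) → (∀ σ n → to α σ (to β σ n) ≡ to γ σ n) →
      (a : Tm Γ τ) → α · (β · a) ≡ γ · a
·-∘ α β γ e (var x) = refl
·-∘ α β γ e (fv τ n) = refl
·-∘ α β γ e (nom τ n) = cong (nom τ) (e τ n)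
·-∘ α β γ e (cst τ n) = refl
·-∘ α β γ e (lam b) = cong lam (·-∘ α β γ e b)
·-∘ α β γ e (app f a) = cong₂ app (·-∘ α β γ e f) (·-∘ α β γ e a)

·-identity : ∀ {Γ τ} (a : Tm Γ τ) → idᴾ · a ≡ a
·-identity (var x) = refl
·-identity (fv τ n) = refl
·-identity (nom τ n) = refl
·-identity (cst τ n) = refl
·-identity (lam b) = cong lam (·-identity b)
·-identity (app f a) = cong₂ app (·-identity f) (·-identity a)

⁻¹ᴾ-·-cancel : ∀ {Γ τ} (π : Perm) (a : Tm Γ τ) → π ⁻¹ᴾ · (π · a) ≡ a
⁻¹ᴾ-·-cancel π a = trans (·-∘ (π ⁻¹ᴾ) π idᴾ (from-to π) a) (·-identity a)

·-ren : ∀ {Γ Δ τ} (π : Perm) (ρ : Ren Γ Δ) (a : Tm Γ τ) → π · ren ρ a ≡ ren ρ (π · a)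
·-ren π ρ (var x) = refl
·-ren π ρ (fv τ n) = refl
·-ren π ρ (nom τ n) = refl
·-ren π ρ (cst τ n) = refl
·-ren π ρ (lam b) = cong lam (·-ren π (liftR ρ) b)
·-ren π ρ (app f a) = cong₂ app (·-ren π ρ f) (·-ren π ρ a)

·-sub : ∀ {Γ Δ τ} (π : Perm) (s s' : Sub Γ Δ) → (∀ {σ} (x : Γ ∋ σ) → π · s x ≡ s' x) →
        (a : Tm Γ τ) → π · sub s a ≡ sub s' (π · a)
·-sub π s s' e (var x) = e x
·-sub π s s' e (fv τ n) = refl
·-sub π s s' e (nom τ n) = refl
·-sub π s s' e (cst τ n) = refl
·-sub π s s' e (lam b) = cong lam (·-sub π (liftS s) (liftS s')
  (λ { here → refl ; (there x) → trans (·-ren π there (s x)) (cong wk (e x)) }) b)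
·-sub π s s' e (app f a) = cong₂ app (·-sub π s s' e f) (·-sub π s s' e a)

·-≃ : ∀ {τ} (π : Perm) {a b : Tm [] τ} → a ≃ b → π · a ≃ π · b
·-≃ π = Compatible.F-≃ {Γ' = []} (λ _ → π ·_) (λ _ → refl) (λ _ _ → refl) (λ _ _ _ → refl)
  (λ _ → ·-ren π there) (λ _ b a → ·-sub π _ _ (λ { here → refl ; (there x) → refl }) b) []

[]-ren : ∀ {Γ Δ τ} (θ : Subst) (ρ : Ren Γ Δ) (a : Tm Γ τ) → ren ρ a [ θ ] ≡ ren ρ (a [ θ ])
[]-ren θ ρ (var x) = refl
[]-ren θ ρ (fv τ n) = sym (ren-wk0 ρ (apply θ τ n))
[]-ren θ ρ (nom τ n) = refl
[]-ren θ ρ (cst τ n) = refl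
[]-ren θ ρ (lam b) = cong lam ([]-ren θ (liftR ρ) b)
[]-ren θ ρ (app f a) = cong₂ app ([]-ren θ ρ f) ([]-ren θ ρ a)

[]-sub : ∀ {Γ Δ τ} (θ : Subst) (s s' : Sub Γ Δ) → (∀ {σ} (x : Γ ∋ σ) → s x [ θ ] ≡ s' x) →
         (a : Tm Γ τ) → sub s a [ θ ] ≡ sub s' (a [ θ ])
[]-sub θ s s' e (var x) = e x
[]-sub θ s s' e (fv τ n) = sym (sub-wk0 s' (apply θ τ n))
[]-sub θ s s' e (nom τ n) = refl
[]-sub θ s s' e (cst τ n) = refl
[]-sub θ s s' e (lam b) = cong lam ([]-sub θ (liftS s) (liftS s')
  (λ { here → refl ; (there x) → trans ([]-ren θ there (s x)) (cong wk (e x)) }) b)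
[]-sub θ s s' e (app f a) = cong₂ app ([]-sub θ s s' e f) ([]-sub θ s s' e a)

[]-≃ : ∀ {τ} (θ : Subst) {a b : Tm [] τ} → a ≃ b → a [ θ ] ≃ b [ θ ]
[]-≃ θ = Compatible.F-≃ {Γ' = []} (λ _ → _[ θ ]) (λ _ → refl) (λ _ _ → refl) (λ _ _ _ → refl)
  (λ _ → []-ren θ there) (λ _ b a → []-sub θ _ _ (λ { here → refl ; (there x) → refl }) b) []

absAt-ren : ∀ Δ Δ' {Γ} σ k {τ} (ρ : Ren (Δ ++ Γ) (Δ' ++ Γ)) (ρ' : Ren (Δ ++ σ ∷ Γ) (Δ' ++ σ ∷ Γ)) →
            (∀ {υ} (x : (Δ ++ Γ) ∋ υ) → ρ' (insV Δ x) ≡ insV Δ' (ρ x)) → ρ' (posV Δ) ≡ posV Δ' →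
            (a : Tm (Δ ++ Γ) τ) → absAt Δ' σ k (ren ρ a) ≡ ren ρ' (absAt Δ σ k a)
absAt-ren Δ Δ' σ k ρ ρ' e p (var x) = cong var (sym (e x))
absAt-ren Δ Δ' σ k ρ ρ' e p (fv τ n) = refl
absAt-ren Δ Δ' σ k ρ ρ' e p (nom τ n) with τ ≟Ty σ | n ℕ.≟ k
... | yes refl | yes refl = cong var (sym p)
... | yes refl | no _ = refl
... | no _ | _ = refl
absAt-ren Δ Δ' σ k ρ ρ' e p (cst τ n) = refl
absAt-ren Δ Δ' σ k ρ ρ' e p (lam {σ = υ} b) = cong lam (absAt-ren (υ ∷ Δ) (υ ∷ Δ') σ k (liftR ρ) (liftR ρ')
  (λ { here → refl ; (there x) → cong there (e x) }) (cong there p) b)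
absAt-ren Δ Δ' σ k ρ ρ' e p (app f a) =
  cong₂ app (absAt-ren Δ Δ' σ k ρ ρ' e p f) (absAt-ren Δ Δ' σ k ρ ρ' e p a)

absAt-wk : ∀ Δ {Γ} σ k {υ τ} (a : Tm (Δ ++ Γ) τ) → absAt (υ ∷ Δ) σ k (wk a) ≡ wk (absAt Δ σ k a)
absAt-wk Δ σ k = absAt-ren Δ (_ ∷ Δ) σ k there there (λ _ → refl) refl

absAt-sub : ∀ Δ Δ' {Γ} σ k {τ} (s : Sub (Δ ++ Γ) (Δ' ++ Γ)) (s' : Sub (Δ ++ σ ∷ Γ) (Δ' ++ σ ∷ Γ)) →
            (∀ {υ} (x : (Δ ++ Γ) ∋ υ) → s' (insV Δ x) ≡ absAt Δ' σ k (s x)) → s' (posV Δ) ≡ var (posV Δ') →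
            (a : Tm (Δ ++ Γ) τ) → absAt Δ' σ k (sub s a) ≡ sub s' (absAt Δ σ k a)
absAt-sub Δ Δ' σ k s s' e p (var x) = sym (e x)
absAt-sub Δ Δ' σ k s s' e p (fv τ n) = refl
absAt-sub Δ Δ' σ k s s' e p (nom τ n) with τ ≟Ty σ | n ℕ.≟ k
... | yes refl | yes refl = sym p
... | yes refl | no _ = refl
... | no _ | _ = refl
absAt-sub Δ Δ' σ k s s' e p (cst τ n) = refl
absAt-sub Δ Δ' σ k s s' e p (lam {σ = υ} b) = cong lam (absAt-sub (υ ∷ Δ) (υ ∷ Δ') σ k (liftS s) (liftS s')
  (λ { here → refl ; (there x) → trans (cong wk (e x)) (sym (absAt-wk Δ' σ k (s x))) }) (cong wk p) b)
absAt-sub Δ Δ' σ k s s' e p (app f a) =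
  cong₂ app (absAt-sub Δ Δ' σ k s s' e p f) (absAt-sub Δ Δ' σ k s s' e p a)

absAt-≃ : ∀ σ k {τ} {a b : Tm [] τ} → a ≃ b → absAt [] σ k a ≃ absAt [] σ k b
absAt-≃ σ k = Compatible.F-≃ (λ Δ → absAt Δ σ k) (λ _ → refl) (λ _ _ → refl) (λ _ _ _ → refl)
  (λ Δ → absAt-wk Δ σ k)
  (λ Δ b a → absAt-sub (_ ∷ Δ) Δ σ k _ _ (λ { here → refl ; (there x) → refl }) refl b) []

·-absAt : ∀ (π : Perm) Δ {Γ} σ k {τ} (a : Tm (Δ ++ Γ) τ) →
          π · absAt Δ σ k a ≡ absAt Δ σ (to π σ k) (π · a)
·-absAt π Δ σ k (var x) = refl
·-absAt π Δ σ k (fv τ n) = refl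
·-absAt π Δ σ k (nom τ n) with τ ≟Ty σ | n ℕ.≟ k | to π τ n ℕ.≟ to π σ k
... | yes refl | yes refl | yes refl = refl
... | yes refl | yes refl | no n≢k = ⊥-elim (n≢k refl)
... | yes refl | no n≢k | yes πn≡πk = ⊥-elim (n≢k (to-injective π τ πn≡πk))
... | yes refl | no _ | no _ = refl
... | no _ | _ | _ = refl
·-absAt π Δ σ k (cst τ n) = refl
·-absAt π Δ σ k (lam {σ = υ} b) = cong lam (·-absAt π (υ ∷ Δ) σ k b)
·-absAt π Δ σ k (app f a) = cong₂ app (·-absAt π Δ σ k f) (·-absAt π Δ σ k a)

lamN-≃ : ∀ {τs τ} (cs : NCs τs) {t t' : Tm [] τ} → t ≃ t' → lamN cs t ≃ lamN cs t'
lamN-≃ [] e = e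
lamN-≃ (_∷_ {x = σ} k ks) e = ≃-lam (absAt-≃ σ k (lamN-≃ ks e))

_·ncs_ : Perm → ∀ {τs} → NCs τs → NCs τs
π ·ncs [] = []
π ·ncs (_∷_ {x = σ} k ks) = to π σ k ∷ π ·ncs ks

ncs-·ncs : ∀ (π : Perm) {τs} (cs : NCs τs) → ncs (π ·ncs cs) ≡ map (π ·nc_) (ncs cs)
ncs-·ncs π [] = refl
ncs-·ncs π (_∷_ {x = σ} k ks) = cong ((σ , to π σ k) ∷_) (ncs-·ncs π ks)

·-lamN : ∀ (π : Perm) {τs τ} (cs : NCs τs) (t : Tm [] τ) → π · lamN cs t ≡ lamN (π ·ncs cs) (π · t)
·-lamN π [] t = refl
·-lamN π (_∷_ {x = σ} k ks) t =
  cong lam (trans (·-absAt π [] σ k (lamN ks t)) (cong (absAt [] σ (to π σ k)) (·-lamN π ks t)))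

Holds-resp-≃ : ∀ {τs τ} {s s' : Tm [] (τs ⇒* τ)} {t t' : Tm [] τ} →
               s ≃ s' → t ≃ t' → Holds s' t' → Holds s t
Holds-resp-≃ s≃s' t≃t' (cs , unique , s'≃λt') =
  cs , unique , ≃-trans s≃s' (≃-trans s'≃λt' (lamN-≃ cs (≃-sym t≃t')))

Holds-· : ∀ (π : Perm) {τs τ} {s : Tm [] (τs ⇒* τ)} {t : Tm [] τ} → Holds s t → Holds (π · s) (π · t)
Holds-· π {t = t} (cs , unique , s≃λt) =
  π ·ncs cs ,
  subst Unique (sym (ncs-·ncs π cs)) (map⁺ (·nc-injective π) unique) ,
  ≃-trans (·-≃ π s≃λt) (≡⇒≃ (·-lamN π cs t))

Occurs-· : ∀ {Γ τ} (π : Perm) (c : NC) (u : Tm Γ τ) → Occurs c (π · u) → Occurs (π ⁻¹ᴾ ·nc c) u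
Occurs-· π (σ , _) (nom .σ m) occ-nom = subst (λ n → Occurs (σ , n) (nom σ m)) (sym (from-to π σ m)) occ-nom
Occurs-· π c (lam b) (occ-lam o) = occ-lam (Occurs-· π c b o)
Occurs-· π c (app f a) (occ-appˡ o) = occ-appˡ (Occurs-· π c f o)
Occurs-· π c (app f a) (occ-appʳ o) = occ-appʳ (Occurs-· π c a o)

∈supp-≃· : ∀ {τ} (π : Perm) (c : NC) {s s' : Tm [] τ} → s ≃ π · s' → c ∈supp s → (π ⁻¹ᴾ ·nc c) ∈supp s'
∈supp-≃· π c s≃πs' c∈s u u≃s' = Occurs-· π c u (c∈s (π · u) (≃-trans (·-≃ π u≃s') (≃-sym s≃πs')))

≈⊵-sym : ∀ {τs τ} {s s' : Tm [] (τs ⇒* τ)} {t t' : Tm [] τ} → s ⊵ t ≈⊵ s' ⊵ t' → s' ⊵ t' ≈⊵ s ⊵ t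
≈⊵-sym (π , s≃πs' , t≃πt') = π ⁻¹ᴾ , invert s≃πs' , invert t≃πt'
  where
  invert : ∀ {υ} {a a' : Tm [] υ} → a ≃ π · a' → a' ≃ π ⁻¹ᴾ · a
  invert {a' = a'} a≃πa' = ≃-sym (≃-trans (·-≃ (π ⁻¹ᴾ) a≃πa') (≡⇒≃ (⁻¹ᴾ-·-cancel π a')))

Holds-resp-≈⊵ : ∀ {τs τ} {s s' : Tm [] (τs ⇒* τ)} {t t' : Tm [] τ} →
                s ⊵ t ≈⊵ s' ⊵ t' → Holds s' t' → Holds s t
Holds-resp-≈⊵ (π , s≃πs' , t≃πt') h = Holds-resp-≃ s≃πs' t≃πt' (Holds-· π h)

Solution-resp-≈⊵ : ∀ {τs τ} {s s' : Tm [] (τs ⇒* τ)} {t t' : Tm [] τ} (θ : Subst) →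
                   s ⊵ t ≈⊵ s' ⊵ t' → Solution θ s' t' → Solution θ s t
Solution-resp-≈⊵ {s = s} {t = t} θ (π , s≃πs' , t≃πt') (ρ , fresh , h) =
  ρ ∘ᴾ π ⁻¹ᴾ , fresh' , Holds-resp-≃ (move s≃πs') (move t≃πt') h
  where
  move : ∀ {υ} {a a' : Tm [] υ} → a ≃ π · a' → ((ρ ∘ᴾ π ⁻¹ᴾ) · a) [ θ ] ≃ (ρ · a') [ θ ]
  move {a' = a'} a≃πa' = []-≃ θ (≃-trans (·-≃ (ρ ∘ᴾ π ⁻¹ᴾ) a≃πa')
    (≡⇒≃ (·-∘ (ρ ∘ᴾ π ⁻¹ᴾ) π ρ (λ σ n → cong (to ρ σ) (from-to π σ n)) a')))
  fresh' : ∀ c → c ∈supp⊵ s , t → ¬ ((ρ ∘ᴾ π ⁻¹ᴾ) ·nc c) ∈suppS θ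
  fresh' c (inj₁ c∈s) = fresh (π ⁻¹ᴾ ·nc c) (inj₁ (∈supp-≃· π c s≃πs' c∈s))
  fresh' c (inj₂ c∈t) = fresh (π ⁻¹ᴾ ·nc c) (inj₂ (∈supp-≃· π c t≃πt' c∈t))

lemma3p10 : ∀ {τs : List Ty} {τ : Ty} (s s' : Tm [] (τs ⇒* τ)) (t t' : Tm [] τ) →
    s ⊵ t ≈⊵ s' ⊵ t' →
    (∀ (θ : Subst) → Solution θ s t ⇔ Solution θ s' t') × (Holds s t ⇔ Holds s' t')
lemma3p10 s s' t t' s⊵t≈s'⊵t' =
  (λ θ → mk⇔ (Solution-resp-≈⊵ θ s'⊵t'≈s⊵t) (Solution-resp-≈⊵ θ s⊵t≈s'⊵t')) ,
  mk⇔ (Holds-resp-≈⊵ s'⊵t'≈s⊵t) (Holds-resp-≈⊵ s⊵t≈s'⊵t')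
  where
  s'⊵t'≈s⊵t : s' ⊵ t' ≈⊵ s ⊵ t
  s'⊵t'≈s⊵t = ≈⊵-sym s⊵t≈s'⊵t'
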